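{- Let $q=p^r$, where $p$ is a prime with $p \equiv 3 \pmod 4$ and $r$ is even. Then $\omega(P^*_q) \leq \sqrt{q}$. Moreover, equality holds if and only if $\mathbb{F}_q=C+g^2C=\{u+g^2v: u,v \in C\}$ for every maximum clique $C$ of $P^*_q$ and every primitive root $g$ of $\mathbb{F}_q$.
   Context: For $q=p^s$ with $p\equiv 3\pmod 4$ prime and $s$ even, the Peisert graph $P^*_q$ has vertex set $\mathbb{F}_q$, two vertices adjacent iff their difference lies in $M_q=\{g^j : j\equiv 0,1 \pmod 4\}$, where $g$ is a primitive root of $\mathbb{F}_q$ (independent of the choice of $g$). A clique is a set of pairwise adjacent vertices; a maximum clique is one of largest size; $\omega$ denotes the clique number. -}

module Defs where

open import Level using (0ℓ)
open import Algebra.Bundles using (CommutativeRing)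
open import Data.Nat using (ℕ; zero; suc; _%_)
open import Data.Fin using (Fin)
open import Data.Product using (Σ; ∃; _×_; _,_)
open import Data.Sum using (_⊎_)
open import Data.List using (List; length)
open import Data.List.Relation.Unary.AllPairs using (AllPairs)
open import Relation.Nullary using (¬_)
open import Relation.Binary.PropositionalEquality using (_≡_)
import Data.List.Membership.Setoid as SetoidMembership

record FiniteField (q : ℕ) : Set₁ where
  field
    commRing : CommutativeRing 0ℓ 0ℓ
  open CommutativeRing commRing public hiding (ring)
  field
    1≉0     : ¬ (1# ≈ 0#)
    inverse : ∀ x → ¬ (x ≈ 0#) → ∃ λ y → x * y ≈ 1#
    -- the carrier has exactly q elements: enum is a bijection Fin q → Carrier (up to ≈)
    enum      : Fin q → Carrier
    enum-surj : ∀ x → ∃ λ i → enum i ≈ x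
    enum-inj  : ∀ i j → enum i ≈ enum j → i ≡ j

module _ {q : ℕ} (F : FiniteField q) where
  open FiniteField F

  pow : Carrier → ℕ → Carrier
  pow x zero    = 1#
  pow x (suc n) = x * pow x n

  PrimitiveRoot : Carrier → Set
  PrimitiveRoot g = ¬ (g ≈ 0#) × (∀ x → ¬ (x ≈ 0#) → ∃ λ j → x ≈ pow g j)

  InM : Carrier → Carrier → Set
  InM g x = ∃ λ j → (j % 4 ≡ 0 ⊎ j % 4 ≡ 1) × x ≈ pow g j

  Adj : Carrier → Carrier → Carrier → Set
  Adj g x y = InM g (x - y)

  -- a clique, as a list of vertices, any two (at different positions) adjacent;
  -- adjacency forces distinctness, so  length C  is the size of the clique
  Clique : Carrier → List Carrier → Set
  Clique g C = AllPairs (λ x y → Adj g x y × Adj g y x) C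

  MaximumClique : Carrier → List Carrier → Set
  MaximumClique g C = Clique g C × (∀ D → Clique g D → length D Data.Nat.≤ length C)

  open SetoidMembership setoid using (_∈_)

  CoversSumset : List Carrier → Carrier → Set
  CoversSumset C h = ∀ x → ∃ λ u → ∃ λ v → u ∈ C × v ∈ C × x ≈ u + pow h 2 * v

-- Write q = s² with s = pᵏ odd. Then 4 ∣ q − 1, so for the primitive root g the class mod 4 of the
-- exponent of a nonzero element is well defined, and M is the set of elements of class 0 or 1. Every
-- primitive root h is gᵉ with e odd, so multiplication by h² = g²ᵉ shifts classes by 2 and M ∩ h²M = ∅.
-- For a clique C the map (u, v) ↦ u + h²v is therefore injective on C × C: an equality u + h²v = u′ + h²v′
-- gives u − u′ = h²(v′ − v), an element of M (or 0) equal to an element of h²M (or 0). Hence |C|² ≤ q, and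
-- equality holds exactly when C + h²C = F_q; a clique of size s = √q exists iff the maximum cliques cover.
module Submission where

open import Defs
open import Data.Nat using (ℕ; _^_; _*_; _%_; _≤_)
open import Data.Nat.Primality using (Prime)
open import Data.List using (List; length)
open import Data.Product using (Σ; _×_)
open import Function.Bundles using (_⇔_)
open import Relation.Binary.PropositionalEquality using (_≡_)

open import Level using (Level)
open import Algebra.Bundles using (CommutativeRing)
open import Data.Nat as ℕ using (zero; suc; _/_; _∸_; _<_; NonZero; s≤s)
open import Data.Nat.Properties as ℕₚ
  using (≤-pred; ≤-trans; ≤-antisym; ≤∧≢⇒<; <-irrefl; ≤-<-trans; ≮⇒≥; ≤-total; *-mono-≤; *-mono-<;
         m∸n≤m; m+[n∸m]≡n; m<n⇒0<n∸m; m≤n⇒∃[o]m+o≡n; <⇒≤; suc-injective; ^-distribˡ-+-*)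
open import Data.Nat.DivMod
  using (m≡m%n+[m/n]*n; m%n<n; %-distribˡ-+; %-distribˡ-*; %-remove-+ʳ; m%n*o≡m*o%[n*o]; m∣n⇒o%n%m≡o%m)
open import Data.Nat.Divisibility using (_∣_; divides; ∣-trans; m%n≡0⇒n∣m)
open import Data.Nat.Tactic.RingSolver using (solve-∀)
open import Data.Fin as Fin using (Fin; toℕ; fromℕ<; punchIn; punchOut; remQuot; combine; finToFun; funToFin)
open import Data.Fin.Properties
  using (¬Fin0; any?; pigeonhole; injective⇒≤; punchOut-injective; punchIn-injective; punchInᵢ≢i;
         toℕ-fromℕ<; toℕ<n; combine-injective; combine-remQuot; finToFun-funToFin)
open import Data.Product using (∃; ∃₂; _,_; proj₁; proj₂; swap; uncurry)
open import Data.Sum using (_⊎_; inj₁; inj₂)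
open import Data.List using ([]; lookup; tabulate)
open import Data.List.Properties using (tabulate-lookup; length-tabulate)
open import Data.List.Relation.Unary.All as All using (All)
open import Data.List.Relation.Unary.AllPairs using (AllPairs; []; _∷_; allPairs?)
import Data.List.Relation.Unary.Any as Any
open import Data.List.Relation.Unary.Any.Properties using (lookup-index)
open import Data.List.Membership.Propositional.Properties using (∈-lookup)
import Data.List.Membership.Setoid.Properties as SetoidMembership
import Data.List.Relation.Binary.Pointwise as Pointwise
open import Function using (_∘_)
open import Function.Bundles using (mk⇔; Equivalence)
open import Function.Definitions using (Injective)
open import Relation.Nullary using (¬_; Dec; yes; no; contradiction)
open import Relation.Nullary.Decidable using (_×-dec_; _⊎-dec_)
open import Relation.Unary using (Pred; Decidable)
open import Relation.Binary using (Symmetric)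
open import Relation.Binary.PropositionalEquality as ≡ using (_≢_)

private variable
  ℓ : Level

m*m≤n*n⇒m≤n : ∀ {m n} → m * m ≤ n * n → m ≤ n
m*m≤n*n⇒m≤n m*m≤n*n = ≮⇒≥ λ n<m → <-irrefl ≡.refl (≤-<-trans m*m≤n*n (*-mono-< n<m n<m))

m^n%2≡1 : ∀ {m} → m % 2 ≡ 1 → ∀ n → (m ^ n) % 2 ≡ 1
m^n%2≡1 m%2≡1 zero = ≡.refl
m^n%2≡1 {m} m%2≡1 (suc n) = ≡.trans (%-distribˡ-* m (m ^ n) 2)
  (≡.cong₂ (λ a b → (a * b) % 2) m%2≡1 (m^n%2≡1 m%2≡1 n))

m*n%2≡1⇒m%2≡1 : ∀ m n → (m * n) % 2 ≡ 1 → m % 2 ≡ 1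
m*n%2≡1⇒m%2≡1 m n odd with m % 2 | m%n<n m 2 | %-distribˡ-* m n 2
... | 0 | _ | even = contradiction (≡.trans (≡.sym odd) even) λ ()
... | 1 | _ | _ = ≡.refl
... | suc (suc _) | s≤s (s≤s ()) | _

[1+2t]²≡1+4[t²+t] : ∀ t → suc (t * 2) * suc (t * 2) ≡ suc ((t * t ℕ.+ t) * 4)
[1+2t]²≡1+4[t²+t] = solve-∀

4∣pred-of-odd-square : ∀ s {N} → s % 2 ≡ 1 → s * s ≡ suc N → 4 ∣ N
4∣pred-of-odd-square s {N} s-odd s*s≡1+N = divides (t * t ℕ.+ t) (suc-injective (begin
  suc N                     ≡⟨ ≡.sym s*s≡1+N ⟩
  s * s                     ≡⟨ ≡.cong₂ _*_ s≡1+2t s≡1+2t ⟩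
  suc (t * 2) * suc (t * 2) ≡⟨ [1+2t]²≡1+4[t²+t] t ⟩
  suc ((t * t ℕ.+ t) * 4)   ∎))
  where
  open ≡.≡-Reasoning
  t : ℕ
  t = s / 2
  s≡1+2t : s ≡ suc (t * 2)
  s≡1+2t = ≡.trans (m≡m%n+[m/n]*n s 2) (≡.cong (ℕ._+ t * 2) s-odd)

residue01-disjoint-residue23 : ∀ {a} → a ≡ 0 ⊎ a ≡ 1 → ¬ (a ≡ 2 ⊎ a ≡ 3)
residue01-disjoint-residue23 (inj₁ ≡.refl) (inj₁ ())
residue01-disjoint-residue23 (inj₁ ≡.refl) (inj₂ ())
residue01-disjoint-residue23 (inj₂ ≡.refl) (inj₁ ())
residue01-disjoint-residue23 (inj₂ ≡.refl) (inj₂ ())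

odd*2+residue01 : ∀ e j → e % 2 ≡ 1 → j % 4 ≡ 0 ⊎ j % 4 ≡ 1 →
                  (e * 2 ℕ.+ j) % 4 ≡ 2 ⊎ (e * 2 ℕ.+ j) % 4 ≡ 3
odd*2+residue01 e j e-odd j-residue =
  ≡.subst (λ r → r ≡ 2 ⊎ r ≡ 3) (≡.sym [e*2+j]%4≡[2+j%4]%4) (shift j-residue)
  where
  [e*2+j]%4≡[2+j%4]%4 : (e * 2 ℕ.+ j) % 4 ≡ (2 ℕ.+ j % 4) % 4
  [e*2+j]%4≡[2+j%4]%4 = ≡.trans (%-distribˡ-+ (e * 2) j 4)
    (≡.cong (λ a → (a ℕ.+ j % 4) % 4) (≡.trans (≡.sym (m%n*o≡m*o%[n*o] e 2 2)) (≡.cong (_* 2) e-odd)))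
  shift : ∀ {r} → r ≡ 0 ⊎ r ≡ 1 → (2 ℕ.+ r) % 4 ≡ 2 ⊎ (2 ℕ.+ r) % 4 ≡ 3
  shift (inj₁ ≡.refl) = inj₁ ≡.refl
  shift (inj₂ ≡.refl) = inj₂ ≡.refl

bounded-maximum : ∀ {P : Pred ℕ ℓ} → Decidable P → P 0 → ∀ s → (∀ {n} → P n → n ≤ s) →
                  ∃ λ n → P n × (∀ {m} → P m → m ≤ n)
bounded-maximum P? P0 s bound with P? s
... | yes Ps = s , Ps , bound
bounded-maximum P? P0 zero    bound | no ¬P0 = contradiction P0 ¬P0
bounded-maximum {P = P} P? P0 (suc s) bound | no ¬Ps =
  bounded-maximum P? P0 s λ Pn → ≤-pred (≤∧≢⇒< (bound Pn) λ n≡1+s → ¬Ps (≡.subst P n≡1+s Pn))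

injective⇒surjective : ∀ {a b} {f : Fin a → Fin b} → Injective _≡_ _≡_ f → b ≤ a →
                       ∀ y → ∃ λ x → f x ≡ y
injective⇒surjective {f = f} f-injective b≤a y with any? (λ x → f x Fin.≟ y)
... | yes found = found
injective⇒surjective {b = suc b} {f = f} f-injective b≤a y | no ¬found =
  contradiction (≤-trans b≤a (injective⇒≤ f′-injective)) (<-irrefl ≡.refl)
  where
  y≢f : ∀ x → y ≢ f x
  y≢f x y≡fx = ¬found (x , ≡.sym y≡fx)
  f′ : Fin _ → Fin b
  f′ x = punchOut (y≢f x)
  f′-injective : Injective _≡_ _≡_ f′
  f′-injective {x} {x′} = f-injective ∘ punchOut-injective (y≢f x) (y≢f x′)

uncurry-combine-injective : ∀ {m n} → Injective _≡_ _≡_ (uncurry (combine {m} {n}))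
uncurry-combine-injective {x = i , j} {k , l} eq with ≡.refl , ≡.refl ← combine-injective i j k l eq = ≡.refl

AllPairs-lookup : ∀ {A : Set} {R : A → A → Set ℓ} → Symmetric R → ∀ {xs} → AllPairs R xs →
                  ∀ {i j} → i ≢ j → R (lookup xs i) (lookup xs j)
AllPairs-lookup sym (_ ∷ _)   {Fin.zero}  {Fin.zero}  0≢0 = contradiction ≡.refl 0≢0
AllPairs-lookup sym (px ∷ _)  {Fin.zero}  {Fin.suc j} _   = All.lookup px (∈-lookup j)
AllPairs-lookup sym (px ∷ _)  {Fin.suc i} {Fin.zero}  _   = sym (All.lookup px (∈-lookup i))
AllPairs-lookup sym (_ ∷ pxs) {Fin.suc i} {Fin.suc j} i≢j = AllPairs-lookup sym pxs (i≢j ∘ ≡.cong Fin.suc)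

module FiniteFieldProperties {q : ℕ} (F : FiniteField q) where
  open FiniteField F renaming (_*_ to _·_)
  open import Relation.Binary.Reasoning.Setoid setoid
  open import Algebra.Properties.Semiring.Exp semiring using (^-congˡ; ^-homo-*; ^-assocʳ) renaming (_^_ to _^ᶠ_)
  open import Data.List.Relation.Binary.Equality.Setoid setoid using (_≋_)

  pow≡^ : ∀ x n → pow F x n ≡ x ^ᶠ n
  pow≡^ x zero    = ≡.refl
  pow≡^ x (suc n) = ≡.cong (x ·_) (pow≡^ x n)

  pow-congˡ : ∀ {x y} n → x ≈ y → pow F x n ≈ pow F y n
  pow-congˡ {x} {y} n x≈y rewrite pow≡^ x n | pow≡^ y n = ^-congˡ n x≈y

  pow-+ : ∀ x m n → pow F x (m ℕ.+ n) ≈ pow F x m · pow F x n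
  pow-+ x m n rewrite pow≡^ x (m ℕ.+ n) | pow≡^ x m | pow≡^ x n = ^-homo-* x m n

  pow-* : ∀ x m n → pow F (pow F x m) n ≈ pow F x (m * n)
  pow-* x m n rewrite pow≡^ (pow F x m) n | pow≡^ x m | pow≡^ x (m * n) = ^-assocʳ x m n

  pow≈1⇒pow-*≈1 : ∀ {x n} → pow F x n ≈ 1# → ∀ k → pow F x (k * n) ≈ 1#
  pow≈1⇒pow-*≈1 xⁿ≈1 zero = refl
  pow≈1⇒pow-*≈1 {x} {n} xⁿ≈1 (suc k) = begin
    pow F x (n ℕ.+ k * n)          ≈⟨ pow-+ x n (k * n) ⟩
    pow F x n · pow F x (k * n)    ≈⟨ *-cong xⁿ≈1 (pow≈1⇒pow-*≈1 xⁿ≈1 k) ⟩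
    1# · 1#                        ≈⟨ *-identityˡ 1# ⟩
    1#                             ∎

  pow-% : ∀ {x n} .{{_ : NonZero n}} → pow F x n ≈ 1# → ∀ m → pow F x m ≈ pow F x (m % n)
  pow-% {x} {n} xⁿ≈1 m = begin
    pow F x m                                  ≡⟨ ≡.cong (pow F x) (m≡m%n+[m/n]*n m n) ⟩
    pow F x (m % n ℕ.+ (m / n) * n)            ≈⟨ pow-+ x (m % n) ((m / n) * n) ⟩
    pow F x (m % n) · pow F x ((m / n) * n)    ≈⟨ *-congˡ (pow≈1⇒pow-*≈1 xⁿ≈1 (m / n)) ⟩
    pow F x (m % n) · 1#                       ≈⟨ *-identityʳ _ ⟩
    pow F x (m % n)                            ∎

  *-cancelˡ : ∀ {x y z} → x ≉ 0# → x · y ≈ x · z → y ≈ z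
  *-cancelˡ {x} {y} {z} x≉0 xy≈xz = begin
    y                ≈⟨ *-identityˡ y ⟨
    1# · y           ≈⟨ *-congʳ x⁻¹x≈1 ⟨
    (x⁻¹ · x) · y    ≈⟨ *-assoc x⁻¹ x y ⟩
    x⁻¹ · (x · y)    ≈⟨ *-congˡ xy≈xz ⟩
    x⁻¹ · (x · z)    ≈⟨ *-assoc x⁻¹ x z ⟨
    (x⁻¹ · x) · z    ≈⟨ *-congʳ x⁻¹x≈1 ⟩
    1# · z           ≈⟨ *-identityˡ z ⟩
    z                ∎
    where
    x⁻¹ : Carrier
    x⁻¹ = proj₁ (inverse x x≉0)
    x⁻¹x≈1 : x⁻¹ · x ≈ 1#
    x⁻¹x≈1 = trans (*-comm x⁻¹ x) (proj₂ (inverse x x≉0))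

  *-nonzero : ∀ {x y} → x ≉ 0# → y ≉ 0# → x · y ≉ 0#
  *-nonzero {x} x≉0 y≉0 xy≈0 = y≉0 (*-cancelˡ x≉0 (trans xy≈0 (sym (zeroʳ x))))

  pow-nonzero : ∀ {x} → x ≉ 0# → ∀ n → pow F x n ≉ 0#
  pow-nonzero x≉0 zero    = 1≉0
  pow-nonzero x≉0 (suc n) = *-nonzero x≉0 (pow-nonzero x≉0 n)

  a+b≈c+d⇒a-c≈d-b : ∀ {a b c d} → a + b ≈ c + d → a - c ≈ d - b
  a+b≈c+d⇒a-c≈d-b {a} {b} {c} {d} a+b≈c+d = begin
    a - c                  ≈⟨ +-congʳ (trans (+-congˡ (-‿inverseʳ b)) (+-identityʳ a)) ⟨
    (a + (b - b)) - c      ≈⟨ +-congʳ (+-assoc a b (- b)) ⟨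
    ((a + b) - b) - c      ≈⟨ +-congʳ (+-congʳ a+b≈c+d) ⟩
    ((c + d) - b) - c      ≈⟨ +-congʳ (+-assoc c d (- b)) ⟩
    (c + (d - b)) - c      ≈⟨ +-congʳ (+-comm c (d - b)) ⟩
    ((d - b) + c) - c      ≈⟨ +-assoc (d - b) c (- c) ⟩
    (d - b) + (c - c)      ≈⟨ +-congˡ (-‿inverseʳ c) ⟩
    (d - b) + 0#           ≈⟨ +-identityʳ _ ⟩
    d - b                  ∎

  index : Carrier → Fin q
  index x = proj₁ (enum-surj x)

  enum-index : ∀ x → enum (index x) ≈ x
  enum-index x = proj₂ (enum-surj x)

  index-injective : ∀ {x y} → index x ≡ index y → x ≈ y
  index-injective {x} {y} eq = trans (sym (enum-index x)) (trans (reflexive (≡.cong enum eq)) (enum-index y))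

  index-nonzero : ∀ {x} → x ≉ 0# → index 0# ≢ index x
  index-nonzero x≉0 eq = x≉0 (sym (index-injective eq))

  _≈?_ : ∀ x y → Dec (x ≈ y)
  x ≈? y with index x Fin.≟ index y
  ... | yes eq = yes (index-injective eq)
  ... | no ¬eq = no λ x≈y → ¬eq (enum-inj _ _ (trans (enum-index x) (trans x≈y (sym (enum-index y)))))

  decode : ∀ n → Fin (q ^ n) → List Carrier
  decode n k = tabulate (enum ∘ finToFun {q} {n} k)

  encode : (xs : List Carrier) → Fin (q ^ length xs)
  encode xs = funToFin (index ∘ lookup xs)

  xs≋decode[encode-xs] : ∀ xs → xs ≋ decode (length xs) (encode xs)
  xs≋decode[encode-xs] xs =
    ≡.subst (_≋ decode (length xs) (encode xs)) (tabulate-lookup xs) (Pointwise.tabulate⁺ λ i →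
    sym (trans (reflexive (≡.cong enum (finToFun-funToFin (index ∘ lookup xs) i))) (enum-index _)))

  any?-ofLength : ∀ {P : Pred (List Carrier) ℓ} → Decidable P → (∀ {xs ys} → xs ≋ ys → P xs → P ys) →
                  ∀ n → Dec (∃ λ xs → P xs × length xs ≡ n)
  any?-ofLength {P = P} P? P-resp n with any? (λ (k : Fin (q ^ n)) → P? (decode n k))
  ... | yes (k , P[decode-k]) = yes (decode n k , P[decode-k] , length-tabulate _)
  ... | no ¬P[decode-k] = no (¬P[decode-k] ∘ encoded)
    where
    encoded : ∀ {n} → (∃ λ xs → P xs × length xs ≡ n) → ∃ λ (k : Fin (q ^ n)) → P (decode n k)
    encoded (xs , Pxs , ≡.refl) = encode xs , P-resp (xs≋decode[encode-xs] xs) Pxs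

module NonzeroElements {N : ℕ} (F : FiniteField (suc N)) where
  open FiniteField F renaming (_*_ to _·_)
  open FiniteFieldProperties F
  open import Relation.Binary.Reasoning.Setoid setoid

  nonzero-pigeonhole : (f : Fin (suc N) → Carrier) → (∀ i → f i ≉ 0#) →
                       ∃₂ λ i j → i Fin.< j × f i ≈ f j
  nonzero-pigeonhole f f≉0 with pigeonhole (ℕₚ.n<1+n N) (λ i → punchOut (index-nonzero (f≉0 i)))
  ... | i , j , i<j , eq =
    i , j , i<j , index-injective (punchOut-injective (index-nonzero (f≉0 i)) (index-nonzero (f≉0 j)) eq)

  nonzero : Fin N → Carrier
  nonzero i = enum (punchIn (index 0#) i)

  nonzero-≉0 : ∀ i → nonzero i ≉ 0#
  nonzero-≉0 i nzᵢ≈0 = punchInᵢ≢i (index 0#) i (enum-inj _ _ (trans nzᵢ≈0 (sym (enum-index 0#))))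

  nonzero-injective : ∀ {i j} → nonzero i ≈ nonzero j → i ≡ j
  nonzero-injective {i} {j} = punchIn-injective (index 0#) i j ∘ enum-inj _ _

  pow-cancelˡ : ∀ {x} → x ≉ 0# → ∀ a d → pow F x (a ℕ.+ d) ≈ pow F x a → pow F x d ≈ 1#
  pow-cancelˡ {x} x≉0 a d xᵃ⁺ᵈ≈xᵃ = *-cancelˡ (pow-nonzero x≉0 a) (begin
    pow F x a · pow F x d    ≈⟨ pow-+ x a d ⟨
    pow F x (a ℕ.+ d)        ≈⟨ xᵃ⁺ᵈ≈xᵃ ⟩
    pow F x a                ≈⟨ *-identityʳ _ ⟨
    pow F x a · 1#           ∎)

  nonzero-pow-periodic : ∀ {x} → x ≉ 0# → ∃ λ d → 0 < d × d ≤ N × pow F x d ≈ 1#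
  nonzero-pow-periodic {x} x≉0 with nonzero-pigeonhole (pow F x ∘ toℕ) (pow-nonzero x≉0 ∘ toℕ)
  ... | i , j , i<j , xⁱ≈xʲ =
    toℕ j ∸ toℕ i , m<n⇒0<n∸m i<j , ≤-trans (m∸n≤m (toℕ j) (toℕ i)) (≤-pred (toℕ<n j)) ,
    pow-cancelˡ x≉0 (toℕ i) _ (trans (reflexive (≡.cong (pow F x) (m+[n∸m]≡n (<⇒≤ i<j)))) (sym xⁱ≈xʲ))

module PrimitiveRootProperties {N : ℕ} (F : FiniteField (suc N)) {g} (g-primitive : PrimitiveRoot F g) where
  open FiniteField F renaming (_*_ to _·_)
  open FiniteFieldProperties F
  open NonzeroElements F
  open import Relation.Binary.Reasoning.Setoid setoid

  g≉0 : g ≉ 0#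
  g≉0 = proj₁ g-primitive

  -- A nonzero element gʲ is determined by j mod n, which injects the N nonzero elements into Fin n.
  N≤period : ∀ {n} .{{_ : NonZero n}} → pow F g n ≈ 1# → N ≤ n
  N≤period {n} gⁿ≈1 = injective⇒≤ {f = residue} residue-injective
    where
    exponent : Fin N → ℕ
    exponent i = proj₁ (proj₂ g-primitive (nonzero i) (nonzero-≉0 i))
    nonzero≈pow : ∀ i → nonzero i ≈ pow F g (exponent i)
    nonzero≈pow i = proj₂ (proj₂ g-primitive (nonzero i) (nonzero-≉0 i))
    residue : Fin N → Fin n
    residue i = fromℕ< (m%n<n (exponent i) n)
    residue-injective : Injective _≡_ _≡_ residue
    residue-injective {i} {j} eq = nonzero-injective (begin
      nonzero i                  ≈⟨ nonzero≈pow i ⟩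
      pow F g (exponent i)       ≈⟨ pow-% gⁿ≈1 (exponent i) ⟩
      pow F g (exponent i % n)   ≡⟨ ≡.cong (pow F g) residues-equal ⟩
      pow F g (exponent j % n)   ≈⟨ pow-% gⁿ≈1 (exponent j) ⟨
      pow F g (exponent j)       ≈⟨ nonzero≈pow j ⟨
      nonzero j                  ∎)
      where
      residues-equal : exponent i % n ≡ exponent j % n
      residues-equal = ≡.trans (≡.sym (toℕ-fromℕ< _)) (≡.trans (≡.cong toℕ eq) (toℕ-fromℕ< _))

  -- N is returned as a successor so that _%_ finds its NonZero instance without normalising a proof.
  pow-N≈1 : ∃ λ n → suc n ≡ N × pow F g (suc n) ≈ 1#
  pow-N≈1 with nonzero-pow-periodic g≉0
  ... | suc n , _ , 1+n≤N , gⁿ⁺¹≈1 = n , ≤-antisym 1+n≤N (N≤period gⁿ⁺¹≈1) , gⁿ⁺¹≈1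

  pow≈1⇒[1+n]∣ : ∀ {n d} → suc n ≡ N → pow F g (suc n) ≈ 1# → pow F g d ≈ 1# → suc n ∣ d
  pow≈1⇒[1+n]∣ {n} {d} 1+n≡N gⁿ⁺¹≈1 gᵈ≈1 with d % suc n in d%[1+n]≡r
  ... | zero  = m%n≡0⇒n∣m d (suc n) d%[1+n]≡r
  ... | suc r = contradiction (≤-<-trans (N≤period gʳ⁺¹≈1) r<N) (<-irrefl ≡.refl)
    where
    r<N : suc r < N
    r<N = ≡.subst₂ _<_ d%[1+n]≡r 1+n≡N (m%n<n d (suc n))
    gʳ⁺¹≈1 : pow F g (suc r) ≈ 1#
    gʳ⁺¹≈1 = begin
      pow F g (suc r)       ≡⟨ ≡.cong (pow F g) d%[1+n]≡r ⟨
      pow F g (d % suc n)   ≈⟨ pow-% gⁿ⁺¹≈1 d ⟨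
      pow F g d             ≈⟨ gᵈ≈1 ⟩
      1#                    ∎

  pow≈1⇒N∣ : ∀ {d} → pow F g d ≈ 1# → N ∣ d
  pow≈1⇒N∣ {d} gᵈ≈1 with n , 1+n≡N , gⁿ⁺¹≈1 ← pow-N≈1 =
    ≡.subst (_∣ d) 1+n≡N (pow≈1⇒[1+n]∣ 1+n≡N gⁿ⁺¹≈1 gᵈ≈1)

  pow-[a+d]≈pow-a⇒%≡ : ∀ {m} .{{_ : NonZero m}} → m ∣ N → ∀ a d →
                       pow F g (a ℕ.+ d) ≈ pow F g a → (a ℕ.+ d) % m ≡ a % m
  pow-[a+d]≈pow-a⇒%≡ m∣N a d gᵃ⁺ᵈ≈gᵃ =
    %-remove-+ʳ a (∣-trans m∣N (pow≈1⇒N∣ (pow-cancelˡ g≉0 a d gᵃ⁺ᵈ≈gᵃ)))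

  pow≈pow⇒%≡ : ∀ {m} .{{_ : NonZero m}} → m ∣ N → ∀ a b → pow F g a ≈ pow F g b → a % m ≡ b % m
  pow≈pow⇒%≡ m∣N a b gᵃ≈gᵇ with ≤-total a b
  ... | inj₁ a≤b with d , ≡.refl ← m≤n⇒∃[o]m+o≡n a≤b =
    ≡.sym (pow-[a+d]≈pow-a⇒%≡ m∣N a d (sym gᵃ≈gᵇ))
  ... | inj₂ b≤a with d , ≡.refl ← m≤n⇒∃[o]m+o≡n b≤a = pow-[a+d]≈pow-a⇒%≡ m∣N b d gᵃ≈gᵇ

CliqueNumberBound : ∀ {q} (F : FiniteField q) → FiniteField.Carrier F → ℕ → Set
CliqueNumberBound F g₀ s =
  ((C : List Carrier) → Clique F g₀ C → length C ≤ s)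
  × ((Σ (List Carrier) (λ C → Clique F g₀ C × length C ≡ s))
     ⇔ ((C : List Carrier) → MaximumClique F g₀ C → (g : Carrier) → PrimitiveRoot F g → CoversSumset F C g))
  where open FiniteField F

module PeisertGraph {N : ℕ} (F : FiniteField (suc N)) {g} (g-primitive : PrimitiveRoot F g) (4∣N : 4 ∣ N) where
  open FiniteField F renaming (_*_ to _·_)
  open FiniteFieldProperties F
  open PrimitiveRootProperties F g-primitive
  open import Relation.Binary.Reasoning.Setoid setoid
  open import Data.List.Relation.Binary.Equality.Setoid setoid using (AllPairs-resp-≋)
  open import Algebra.Properties.Ring (CommutativeRing.ring commRing) using (x[y-z]≈xy-xz)
  open Equivalence

  InM-resp : ∀ {x y} → x ≈ y → InM F g x → InM F g y
  InM-resp x≈y (j , j-residue , x≈gʲ) = j , j-residue , trans (sym x≈y) x≈gʲ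

  InM⇒≉0 : ∀ {x} → InM F g x → x ≉ 0#
  InM⇒≉0 (j , _ , x≈gʲ) x≈0 = pow-nonzero g≉0 j (trans (sym x≈gʲ) x≈0)

  pow-InM⇒residue01 : ∀ j → InM F g (pow F g j) → j % 4 ≡ 0 ⊎ j % 4 ≡ 1
  pow-InM⇒residue01 j (j′ , j′-residue , gʲ≈gʲ′) =
    ≡.subst (λ r → r ≡ 0 ⊎ r ≡ 1) (≡.sym (pow≈pow⇒%≡ 4∣N j j′ gʲ≈gʲ′)) j′-residue

  InM? : ∀ x → Dec (InM F g x)
  InM? x with x ≈? 0#
  ... | yes x≈0 = no λ x∈M → InM⇒≉0 x∈M x≈0
  ... | no x≉0 with j , x≈gʲ ← proj₂ g-primitive x x≉0 with (j % 4 ℕ.≟ 0) ⊎-dec (j % 4 ℕ.≟ 1)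
  ...   | yes j-residue = yes (j , j-residue , x≈gʲ)
  ...   | no ¬j-residue = no (¬j-residue ∘ pow-InM⇒residue01 j ∘ InM-resp x≈gʲ)

  -- g = hᵗ = gᵉᵗ forces e t ≡ 1 modulo 2, which divides the order N of g.
  primitiveRoot-odd-exponent : ∀ {h} → PrimitiveRoot F h → ∃ λ e → h ≈ pow F g e × e % 2 ≡ 1
  primitiveRoot-odd-exponent {h} (h≉0 , h-generates) with e , h≈gᵉ ← proj₂ g-primitive h h≉0
    with t , g≈hᵗ ← h-generates g g≉0 =
    e , h≈gᵉ , m*n%2≡1⇒m%2≡1 e t (≡.sym (pow≈pow⇒%≡ 2∣N 1 (e * t) g¹≈gᵉᵗ))
    where
    2∣N : 2 ∣ N
    2∣N = ∣-trans (divides 2 ≡.refl) 4∣N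
    g¹≈gᵉᵗ : pow F g 1 ≈ pow F g (e * t)
    g¹≈gᵉᵗ = begin
      g · 1#              ≈⟨ *-identityʳ g ⟩
      g                   ≈⟨ g≈hᵗ ⟩
      pow F h t           ≈⟨ pow-congˡ t h≈gᵉ ⟩
      pow F (pow F g e) t ≈⟨ pow-* g e t ⟩
      pow F g (e * t)     ∎

  InM-disjoint-h²InM : ∀ {h x y} → PrimitiveRoot F h → InM F g x → InM F g y → x ≉ pow F h 2 · y
  InM-disjoint-h²InM {h} {x} {y} h-primitive x∈M (j , j-residue , y≈gʲ) x≈h²y
    with e , h≈gᵉ , e-odd ← primitiveRoot-odd-exponent h-primitive =
    residue01-disjoint-residue23 (pow-InM⇒residue01 (e * 2 ℕ.+ j) (InM-resp x≈gᵉ²⁺ʲ x∈M))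
      (odd*2+residue01 e j e-odd j-residue)
    where
    x≈gᵉ²⁺ʲ : x ≈ pow F g (e * 2 ℕ.+ j)
    x≈gᵉ²⁺ʲ = begin
      x                               ≈⟨ x≈h²y ⟩
      pow F h 2 · y                   ≈⟨ *-cong (trans (pow-congˡ 2 h≈gᵉ) (pow-* g e 2)) y≈gʲ ⟩
      pow F g (e * 2) · pow F g j     ≈⟨ pow-+ g (e * 2) j ⟨
      pow F g (e * 2 ℕ.+ j)           ∎

  Adjacent : Carrier → Carrier → Set
  Adjacent x y = Adj F g x y × Adj F g y x

  Adj-resp : ∀ {x x′ y y′} → x ≈ x′ → y ≈ y′ → Adj F g x y → Adj F g x′ y′
  Adj-resp x≈x′ y≈y′ = InM-resp (+-cong x≈x′ (-‿cong y≈y′))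

  Adjacent-resp : (∀ {x} {y y′} → y ≈ y′ → Adjacent x y → Adjacent x y′) ×
                  (∀ {y} {x x′} → x ≈ x′ → Adjacent x y → Adjacent x′ y)
  Adjacent-resp = (λ y≈y′ (xy , yx) → Adj-resp refl y≈y′ xy , Adj-resp y≈y′ refl yx)
                , (λ x≈x′ (xy , yx) → Adj-resp x≈x′ refl xy , Adj-resp refl x≈x′ yx)

  Clique? : ∀ C → Dec (Clique F g C)
  Clique? = allPairs? λ x y → InM? (x - y) ×-dec InM? (y - x)

  clique-diff-InM : ∀ {C} → Clique F g C → ∀ {i j} → i ≢ j → InM F g (lookup C i - lookup C j)
  clique-diff-InM clique i≢j = proj₁ (AllPairs-lookup swap clique i≢j)

  maximumClique-exists : ∀ s → (∀ C → Clique F g C → length C ≤ s) → ∃ (MaximumClique F g)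
  maximumClique-exists s bound
    with n , (C , clique , ≡.refl) , maximal ←
      bounded-maximum (any?-ofLength Clique? (AllPairs-resp-≋ Adjacent-resp)) ([] , [] , ≡.refl) s
        (λ (C , clique , |C|≡n) → ≡.subst (_≤ s) |C|≡n (bound C clique))
    = C , clique , λ D D-clique → maximal (D , D-clique , ≡.refl)

  module Sumset {C : List Carrier} (clique : Clique F g C) {h} (h-primitive : PrimitiveRoot F h) where
    m : ℕ
    m = length C

    c : Fin m → Carrier
    c = lookup C

    sum : Fin m × Fin m → Carrier
    sum (i , j) = c i + pow F h 2 · c j

    sum≈sum⇒diff≈h²diff : ∀ {i j i′ j′} → sum (i , j) ≈ sum (i′ , j′) →
                          c i - c i′ ≈ pow F h 2 · (c j′ - c j)
    sum≈sum⇒diff≈h²diff {j = j} {j′ = j′} eq =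
      trans (a+b≈c+d⇒a-c≈d-b eq) (sym (x[y-z]≈xy-xz (pow F h 2) (c j′) (c j)))

    sum-injective : Injective _≡_ _≈_ sum
    sum-injective {i , j} {i′ , j′} eq with i Fin.≟ i′ | j Fin.≟ j′
    ... | yes ≡.refl | yes ≡.refl = ≡.refl
    ... | yes ≡.refl | no j≢j′ = contradiction (trans (sym (sum≈sum⇒diff≈h²diff eq)) (-‿inverseʳ (c i)))
      (*-nonzero (pow-nonzero (proj₁ h-primitive) 2) (InM⇒≉0 (clique-diff-InM clique (j≢j′ ∘ ≡.sym))))
    ... | no i≢i′ | yes ≡.refl = contradiction
      (trans (sum≈sum⇒diff≈h²diff eq) (trans (*-congˡ (-‿inverseʳ (c j))) (zeroʳ _)))
      (InM⇒≉0 (clique-diff-InM clique i≢i′))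
    ... | no i≢i′ | no j≢j′ = contradiction (sum≈sum⇒diff≈h²diff eq)
      (InM-disjoint-h²InM h-primitive (clique-diff-InM clique i≢i′) (clique-diff-InM clique (j≢j′ ∘ ≡.sym)))

    code : Fin (m * m) → Fin (suc N)
    code k = index (sum (remQuot {m} m k))

    code-injective : Injective _≡_ _≡_ code
    code-injective {k} {k′} eq = ≡.trans (≡.sym (combine-remQuot {m} m k))
      (≡.trans (≡.cong (uncurry combine) (sum-injective (index-injective eq))) (combine-remQuot {m} m k′))

    length²≤q : m * m ≤ suc N
    length²≤q = injective⇒≤ code-injective

    covers⇔q≤length² : CoversSumset F C h ⇔ suc N ≤ m * m
    covers⇔q≤length² = mk⇔ covers⇒q≤length² q≤length²⇒covers
      where
      covers⇒q≤length² : CoversSumset F C h → suc N ≤ m * m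
      covers⇒q≤length² covers = injective⇒≤ decode-injective
        where
        position : ∀ t → Fin m × Fin m
        position t with u , v , u∈C , v∈C , _ ← covers (enum t) = Any.index u∈C , Any.index v∈C
        enum≈sum : ∀ t → enum t ≈ sum (position t)
        enum≈sum t with u , v , u∈C , v∈C , enum-t≈u+h²v ← covers (enum t) =
          trans enum-t≈u+h²v (+-cong (lookup-index u∈C) (*-congˡ (lookup-index v∈C)))
        decode-injective : Injective _≡_ _≡_ (uncurry combine ∘ position)
        decode-injective {t} {t′} eq = enum-inj t t′ (begin
          enum t             ≈⟨ enum≈sum t ⟩
          sum (position t)   ≡⟨ ≡.cong sum (uncurry-combine-injective eq) ⟩
          sum (position t′)  ≈⟨ enum≈sum t′ ⟨
          enum t′            ∎)
      q≤length²⇒covers : suc N ≤ m * m → CoversSumset F C h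
      q≤length²⇒covers q≤m² x
        with k , code-k≡index-x ← injective⇒surjective code-injective q≤m² (index x) =
        c i , c j , SetoidMembership.∈-lookup setoid C i , SetoidMembership.∈-lookup setoid C j , (begin
          x                      ≈⟨ enum-index x ⟨
          enum (index x)         ≡⟨ ≡.cong enum code-k≡index-x ⟨
          enum (code k)          ≈⟨ enum-index _ ⟩
          sum (i , j)            ∎)
        where
        i j : Fin m
        i = proj₁ (remQuot {m} m k)
        j = proj₂ (remQuot {m} m k)

  clique-number : ∀ s → s * s ≡ suc N → CliqueNumberBound F g s
  clique-number s s*s≡q = clique-bound , mk⇔ maximum-covers clique-of-size-s
    where
    open Sumset
    clique-bound : ∀ C → Clique F g C → length C ≤ s
    clique-bound C clique =
      m*m≤n*n⇒m≤n (≡.subst (length C * length C ≤_) (≡.sym s*s≡q) (length²≤q clique g-primitive))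
    maximum-covers : (∃ λ C → Clique F g C × length C ≡ s) →
                     ∀ C → MaximumClique F g C → ∀ h → PrimitiveRoot F h → CoversSumset F C h
    maximum-covers (C₀ , C₀-clique , |C₀|≡s) C (clique , maximum) h h-primitive =
      from (covers⇔q≤length² clique h-primitive)
        (≡.subst (_≤ length C * length C) s*s≡q (*-mono-≤ s≤|C| s≤|C|))
      where
      s≤|C| : s ≤ length C
      s≤|C| = ≡.subst (_≤ length C) |C₀|≡s (maximum C₀ C₀-clique)
    clique-of-size-s : (∀ C → MaximumClique F g C → ∀ h → PrimitiveRoot F h → CoversSumset F C h) →
                       ∃ λ C → Clique F g C × length C ≡ s
    clique-of-size-s maximum-covers with C , clique , maximum ← maximumClique-exists s clique-bound =
      C , clique , ≤-antisym (clique-bound C clique)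
        (m*m≤n*n⇒m≤n (≡.subst (_≤ length C * length C) (≡.sym s*s≡q)
          (to (covers⇔q≤length² clique g-primitive) (maximum-covers C (clique , maximum) g g-primitive))))

peisert-clique-number : ∀ {q} (F : FiniteField q) s → s % 2 ≡ 1 → s * s ≡ q →
                        ∀ g₀ → PrimitiveRoot F g₀ → CliqueNumberBound F g₀ s
peisert-clique-number {zero} F _ _ _ _ _ = contradiction (proj₁ (FiniteField.enum-surj F (FiniteField.0# F))) ¬Fin0
peisert-clique-number {suc N} F s s-odd s*s≡q g₀ g₀-primitive =
  PeisertGraph.clique-number F g₀-primitive (4∣pred-of-odd-square s s-odd s*s≡q) s s*s≡q

lemma4p1 : (p r k : ℕ) → Prime p → p % 4 ≡ 3 → r ≡ 2 * k →
    (F : FiniteField (p ^ r)) → (g₀ : FiniteField.Carrier F) → PrimitiveRoot F g₀ →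
    ((C : List (FiniteField.Carrier F)) → Clique F g₀ C → length C ≤ p ^ k)
    × ((Σ (List (FiniteField.Carrier F)) (λ C → Clique F g₀ C × length C ≡ p ^ k))
    ⇔ ((C : List (FiniteField.Carrier F)) → MaximumClique F g₀ C →
    (g : FiniteField.Carrier F) → PrimitiveRoot F g → CoversSumset F C g))
lemma4p1 p r k _ p%4≡3 ≡.refl F = peisert-clique-number F (p ^ k) (m^n%2≡1 p%2≡1 k) pᵏ*pᵏ≡p²ᵏ
  where
  p%2≡1 : p % 2 ≡ 1
  p%2≡1 = ≡.trans (≡.sym (m∣n⇒o%n%m≡o%m 2 4 p (divides 2 ≡.refl))) (≡.cong (_% 2) p%4≡3)
  pᵏ*pᵏ≡p²ᵏ : p ^ k * p ^ k ≡ p ^ (2 * k)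
  pᵏ*pᵏ≡p²ᵏ =
    ≡.trans (≡.sym (^-distribˡ-+-* p k k)) (≡.cong (λ e → p ^ (k ℕ.+ e)) (≡.sym (ℕₚ.+-identityʳ k)))
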